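{- Let $B=5$, let $\tilde p>0$ be an integer and $\tilde q$ a positive integer with $\tilde q\geqslant 3600\sqrt[3]{|\tilde p|}$. Let $F_2=B^{2}\tilde q^{6}-2B\tilde q^{4}-2B\tilde p\tilde q^{3}-2\tilde q^{2}+2\tilde p\tilde q+\tilde p^{2}-\frac5B-\frac{20}{B^{2}\tilde q^{2}}$. Then there is no integer $t$ with $F_2-\frac{10\tilde p}{B^{2}\tilde q^{3}}<t<F_2$. -}

module Defs where

open import Data.Nat as ℕ using (ℕ; zero; suc)
open import Data.Integer as ℤ using (ℤ; +_)
open import Data.Rational using (ℚ; _/_; _+_; _-_; _*_; 0ℚ)

⟦_⟧ : ℤ → ℚ
⟦ z ⟧ = z / 1

-- reciprocal 1/n of a natural number (the value at n = 0 is an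
-- irrelevant convention; it is only used with n > 0)
recip : ℕ → ℚ
recip zero    = 0ℚ
recip (suc n) = + 1 / suc n

B : ℚ
B = + 5 / 1

F₂ : ℤ → ℕ → ℚ
F₂ p q =
  B * B * Q * Q * Q * Q * Q * Q
  - ⟦ + 2 ⟧ * B * Q * Q * Q * Q
  - ⟦ + 2 ⟧ * B * P * Q * Q * Q
  - ⟦ + 2 ⟧ * Q * Q
  + ⟦ + 2 ⟧ * P * Q
  + P * P
  - ⟦ + 5 ⟧ * (+ 1 / 5)
  - ⟦ + 20 ⟧ * (+ 1 / 25) * r * r
  where
    P = ⟦ p ⟧
    Q = ⟦ + q ⟧
    r = recip q

{-# OPTIONS --safe #-}
-- The terms of F₂ other than 5/B and 20/(B²q²) are integers and 5/B = 1, so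
-- F₂ = N − ε with N ∈ ℤ and ε = 20/(B²q²) ≤ 4/5.  The width δ = 10p/(B²q³) of
-- the interval is at most 1/25, because q³ ≥ 3600³ p ≥ 10 p.  As ε + δ < 1,
-- the interval (F₂ − δ, F₂) lies inside (N − 1, N), which contains no integer.
module Submission where

open import Data.Fin using (Fin; zero; suc)
open import Data.Integer as ℤ using (ℤ; +_; -[1+_])
import Data.Integer.Properties as ℤP
open import Data.Nat as ℕ using (ℕ; zero; suc)
import Data.Nat.Coprimality as Coprime
import Data.Nat.Properties as ℕP
open import Data.Product using (_×_; _,_)
open import Data.Rational
  using (ℚ; mkℚ; _/_; _+_; _-_; _*_; -_; _<_; _≤_; 0ℚ; 1ℚ; NonNegative; *≤*; *<*)
open import Data.Rational.Properties
open import Data.Rational.Solver using (module +-*-Solver)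
open import Data.Vec using (Vec; []; _∷_; lookup)
open import Relation.Binary.PropositionalEquality
open import Relation.Nullary using (¬_)
open import Relation.Nullary.Decidable using (toWitness)

open import Defs

⟦⟧≡mkℚ : ∀ z → ⟦ z ⟧ ≡ mkℚ z 0 (Coprime.sym (Coprime.1-coprimeTo ℤ.∣ z ∣))
⟦⟧≡mkℚ (+ n)    = normalize-coprime (Coprime.sym (Coprime.1-coprimeTo n))
⟦⟧≡mkℚ -[1+ n ] = cong -_ (normalize-coprime (Coprime.sym (Coprime.1-coprimeTo (suc n))))

⟦⟧-homo-* : ∀ a b → ⟦ a ℤ.* b ⟧ ≡ ⟦ a ⟧ * ⟦ b ⟧
⟦⟧-homo-* a b rewrite ⟦⟧≡mkℚ a | ⟦⟧≡mkℚ b = refl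

⟦⟧-homo-+ : ∀ a b → ⟦ a ℤ.+ b ⟧ ≡ ⟦ a ⟧ + ⟦ b ⟧
⟦⟧-homo-+ a b rewrite ⟦⟧≡mkℚ a | ⟦⟧≡mkℚ b | ℤP.*-identityʳ a | ℤP.*-identityʳ b = refl

⟦⟧-homo-neg : ∀ a → ⟦ ℤ.- a ⟧ ≡ - ⟦ a ⟧
⟦⟧-homo-neg (+ zero)  = refl
⟦⟧-homo-neg (+ suc n) = refl
⟦⟧-homo-neg -[1+ n ] rewrite ⟦⟧≡mkℚ -[1+ n ] | ⟦⟧≡mkℚ (+ suc n) = refl

⟦⟧-homo-minus : ∀ a b → ⟦ a ℤ.- b ⟧ ≡ ⟦ a ⟧ - ⟦ b ⟧
⟦⟧-homo-minus a b = trans (⟦⟧-homo-+ a (ℤ.- b)) (cong (_+_ ⟦ a ⟧) (⟦⟧-homo-neg b))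

⟦⟧-mono-≤ : ∀ {a b} → a ℤ.≤ b → ⟦ a ⟧ ≤ ⟦ b ⟧
⟦⟧-mono-≤ {a} {b} a≤b rewrite ⟦⟧≡mkℚ a | ⟦⟧≡mkℚ b =
  *≤* (subst₂ ℤ._≤_ (sym (ℤP.*-identityʳ a)) (sym (ℤP.*-identityʳ b)) a≤b)

⟦⟧-cancel-< : ∀ {a b} → ⟦ a ⟧ < ⟦ b ⟧ → a ℤ.< b
⟦⟧-cancel-< {a} {b} lt rewrite ⟦⟧≡mkℚ a | ⟦⟧≡mkℚ b with lt
... | *<* a<b = subst₂ ℤ._<_ (ℤP.*-identityʳ a) (ℤP.*-identityʳ b) a<b

no-integer-in-unit-interval : ∀ n t → ¬ (⟦ n ⟧ - 1ℚ < ⟦ t ⟧ × ⟦ t ⟧ < ⟦ n ⟧)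
no-integer-in-unit-interval n t (lo , hi) = ℤP.<⇒≱ (⟦⟧-cancel-< hi) n≤t
  where
  n-1<t : n ℤ.- + 1 ℤ.< t
  n-1<t = ⟦⟧-cancel-< (subst (_< ⟦ t ⟧) (sym (⟦⟧-homo-minus n (+ 1))) lo)
  suc[n-1]≡n : ℤ.suc (n ℤ.- + 1) ≡ n
  suc[n-1]≡n = trans (cong ℤ.suc (ℤP.+-comm n ℤ.-1ℤ)) (ℤP.suc-pred n)
  n≤t : n ℤ.≤ t
  n≤t = subst (ℤ._≤ t) suc[n-1]≡n (ℤP.i<j⇒suc[i]≤j n-1<t)

infixl 6 _⊕_ _⊖_
infixl 7 _⊗_

data Poly (n : ℕ) : Set where
  var         : Fin n → Poly n
  con         : ℤ → Poly n
  _⊕_ _⊖_ _⊗_ : Poly n → Poly n → Poly n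

evalℤ : ∀ {n} → Vec ℤ n → Poly n → ℤ
evalℤ ρ (var i) = lookup ρ i
evalℤ ρ (con c) = c
evalℤ ρ (e ⊕ f) = evalℤ ρ e ℤ.+ evalℤ ρ f
evalℤ ρ (e ⊖ f) = evalℤ ρ e ℤ.- evalℤ ρ f
evalℤ ρ (e ⊗ f) = evalℤ ρ e ℤ.* evalℤ ρ f

evalℚ : ∀ {n} → Vec ℤ n → Poly n → ℚ
evalℚ ρ (var i) = ⟦ lookup ρ i ⟧
evalℚ ρ (con c) = ⟦ c ⟧
evalℚ ρ (e ⊕ f) = evalℚ ρ e + evalℚ ρ f
evalℚ ρ (e ⊖ f) = evalℚ ρ e - evalℚ ρ f
evalℚ ρ (e ⊗ f) = evalℚ ρ e * evalℚ ρ f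

evalℚ≡⟦evalℤ⟧ : ∀ {n} (ρ : Vec ℤ n) e → evalℚ ρ e ≡ ⟦ evalℤ ρ e ⟧
evalℚ≡⟦evalℤ⟧ ρ (var i) = refl
evalℚ≡⟦evalℤ⟧ ρ (con c) = refl
evalℚ≡⟦evalℤ⟧ ρ (e ⊕ f)
  rewrite evalℚ≡⟦evalℤ⟧ ρ e | evalℚ≡⟦evalℤ⟧ ρ f = sym (⟦⟧-homo-+ (evalℤ ρ e) (evalℤ ρ f))
evalℚ≡⟦evalℤ⟧ ρ (e ⊖ f)
  rewrite evalℚ≡⟦evalℤ⟧ ρ e | evalℚ≡⟦evalℤ⟧ ρ f = sym (⟦⟧-homo-minus (evalℤ ρ e) (evalℤ ρ f))
evalℚ≡⟦evalℤ⟧ ρ (e ⊗ f)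
  rewrite evalℚ≡⟦evalℤ⟧ ρ e | evalℚ≡⟦evalℤ⟧ ρ f = sym (⟦⟧-homo-* (evalℤ ρ e) (evalℤ ρ f))

-- B²q⁶ − 2Bq⁴ − 2Bpq³ − 2q² + 2pq + p² − 5/B, with 5/B written as 1
integerPart : Poly 2
integerPart =
  c 5 ⊗ c 5 ⊗ q ⊗ q ⊗ q ⊗ q ⊗ q ⊗ q
  ⊖ c 2 ⊗ c 5 ⊗ q ⊗ q ⊗ q ⊗ q
  ⊖ c 2 ⊗ c 5 ⊗ p ⊗ q ⊗ q ⊗ q
  ⊖ c 2 ⊗ q ⊗ q
  ⊕ c 2 ⊗ p ⊗ q
  ⊕ p ⊗ p
  ⊖ c 1
  where
  c : ℕ → Poly 2
  c n = con (+ n)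
  p q : Poly 2
  p = var zero
  q = var (suc zero)

ε : ℕ → ℚ
ε q = ⟦ + 20 ⟧ * (+ 1 / 25) * recip q * recip q

δ : ℤ → ℕ → ℚ
δ p q = ⟦ + 10 ⟧ * ⟦ p ⟧ * (+ 1 / 25) * recip q * recip q * recip q

F₂≡integerPart-ε : ∀ p q → F₂ p q ≡ ⟦ evalℤ (p ∷ + q ∷ []) integerPart ⟧ - ε q
F₂≡integerPart-ε p q = cong (_- ε q) (evalℚ≡⟦evalℤ⟧ (p ∷ + q ∷ []) integerPart)

minus-antimonoʳ-≤ : ∀ x {a b} → a ≤ b → x - b ≤ x - a
minus-antimonoʳ-≤ x a≤b = +-monoʳ-≤ x (neg-antimono-≤ a≤b)

minus-+ : ∀ x a b → x - (a + b) ≡ x - a - b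
minus-+ x a b = trans (cong (_+_ x) (neg-distrib-+ a b)) (sym (+-assoc x (- a) (- b)))

no-integer-in-subinterval : ∀ n t e d → 0ℚ ≤ e → e + d ≤ 1ℚ →
                     ¬ (⟦ n ⟧ - e - d < ⟦ t ⟧ × ⟦ t ⟧ < ⟦ n ⟧ - e)
no-integer-in-subinterval n t e d 0≤e e+d≤1 (lo , hi) =
  no-integer-in-unit-interval n t (≤-<-trans n-1≤lower lo , <-≤-trans hi upper≤n)
  where
  n-1≤lower : ⟦ n ⟧ - 1ℚ ≤ ⟦ n ⟧ - e - d
  n-1≤lower = subst (⟦ n ⟧ - 1ℚ ≤_) (minus-+ ⟦ n ⟧ e d) (minus-antimonoʳ-≤ ⟦ n ⟧ e+d≤1)
  upper≤n : ⟦ n ⟧ - e ≤ ⟦ n ⟧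
  upper≤n = subst (⟦ n ⟧ - e ≤_) (+-identityʳ ⟦ n ⟧) (minus-antimonoʳ-≤ ⟦ n ⟧ 0≤e)

recip≡mkℚ : ∀ n → recip (suc n) ≡ mkℚ (+ 1) n (Coprime.1-coprimeTo (suc n))
recip≡mkℚ n = normalize-coprime (Coprime.1-coprimeTo (suc n))

recip-nonNeg : ∀ q → NonNegative (recip q)
recip-nonNeg zero    = _
recip-nonNeg (suc n) = subst NonNegative (sym (recip≡mkℚ n)) _

recip-≤-1 : ∀ q → recip q ≤ 1ℚ
recip-≤-1 zero    = *≤* (ℤ.+≤+ ℕ.z≤n)
recip-≤-1 (suc n) = subst (_≤ 1ℚ) (sym (recip≡mkℚ n)) (*≤* (ℤ.+≤+ (ℕ.s≤s ℕ.z≤n)))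

recip-inverseʳ : ∀ n → ⟦ + suc n ⟧ * recip (suc n) ≡ 1ℚ
recip-inverseʳ n rewrite ⟦⟧≡mkℚ (+ suc n) | recip≡mkℚ n =
  *-inverseʳ (mkℚ (+ suc n) 0 (Coprime.sym (Coprime.1-coprimeTo (suc n))))

x*r≤x : ∀ x .{{_ : NonNegative x}} {r} → r ≤ 1ℚ → x * r ≤ x
x*r≤x x {r} r≤1 = subst (x * r ≤_) (*-identityʳ x) (*-monoˡ-≤-nonNeg x r≤1)

*-cube-≤-1 : ∀ {a Q} r .{{_ : NonNegative r}} → a ≤ Q * Q * Q → Q * r ≡ 1ℚ →
             a * r * r * r ≤ 1ℚ
*-cube-≤-1 {a} {Q} r a≤Q³ Qr≡1 = begin
  a * r * r * r             ≤⟨ *-monoʳ-≤-nonNeg r (*-monoʳ-≤-nonNeg r (*-monoʳ-≤-nonNeg r a≤Q³)) ⟩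
  Q * Q * Q * r * r * r     ≡⟨ regroup Q r ⟩
  (Q * r) * (Q * r) * (Q * r) ≡⟨ cong (λ x → x * x * x) Qr≡1 ⟩
  1ℚ                        ∎
  where
  open ≤-Reasoning
  regroup : ∀ Q r → Q * Q * Q * r * r * r ≡ (Q * r) * (Q * r) * (Q * r)
  regroup = solve 2 (λ Q r → Q :* Q :* Q :* r :* r :* r := (Q :* r) :* (Q :* r) :* (Q :* r)) refl
    where open +-*-Solver using (solve; _:*_; _:=_)

module _ (q : ℕ) where
  private instance
    recip-q-nonNeg : NonNegative (recip q)
    recip-q-nonNeg = recip-nonNeg q
    20/25*recip-q-nonNeg : NonNegative (⟦ + 20 ⟧ * (+ 1 / 25) * recip q)
    20/25*recip-q-nonNeg = nonNeg*nonNeg⇒nonNeg (⟦ + 20 ⟧ * (+ 1 / 25)) (recip q)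

  ε-nonNeg : 0ℚ ≤ ε q
  ε-nonNeg = nonNegative⁻¹ (ε q)
    {{nonNeg*nonNeg⇒nonNeg (⟦ + 20 ⟧ * (+ 1 / 25) * recip q) (recip q)}}

  ε≤4/5 : ε q ≤ + 4 / 5
  ε≤4/5 = ≤-trans (x*r≤x (⟦ + 20 ⟧ * (+ 1 / 25) * recip q) (recip-≤-1 q))
                  (x*r≤x (⟦ + 20 ⟧ * (+ 1 / 25)) (recip-≤-1 q))

  δ≤1/25 : ∀ p → ⟦ + 10 ⟧ * ⟦ p ⟧ ≤ ⟦ + q ⟧ * ⟦ + q ⟧ * ⟦ + q ⟧ →
           ⟦ + q ⟧ * recip q ≡ 1ℚ → δ p q ≤ + 1 / 25
  δ≤1/25 p 10p≤q³ qr≡1 = begin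
    δ p q                   ≡⟨ pull-out (⟦ + 10 ⟧ * ⟦ p ⟧) (+ 1 / 25) (recip q) ⟩
    + 1 / 25 * (⟦ + 10 ⟧ * ⟦ p ⟧ * recip q * recip q * recip q)
                            ≤⟨ x*r≤x (+ 1 / 25) (*-cube-≤-1 {Q = ⟦ + q ⟧} (recip q) 10p≤q³ qr≡1) ⟩
    + 1 / 25                ∎
    where
    open ≤-Reasoning
    pull-out : ∀ a k r → a * k * r * r * r ≡ k * (a * r * r * r)
    pull-out = solve 3 (λ a k r → a :* k :* r :* r :* r := k :* (a :* r :* r :* r)) refl
      where open +-*-Solver using (solve; _:*_; _:=_)

  ε+δ≤1 : ∀ p → ⟦ + 10 ⟧ * ⟦ p ⟧ ≤ ⟦ + q ⟧ * ⟦ + q ⟧ * ⟦ + q ⟧ →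
          ⟦ + q ⟧ * recip q ≡ 1ℚ → ε q + δ p q ≤ 1ℚ
  ε+δ≤1 p 10p≤q³ qr≡1 = ≤-trans (+-mono-≤ ε≤4/5 (δ≤1/25 p 10p≤q³ qr≡1))
    (toWitness {a? = + 4 / 5 + + 1 / 25 ≤? 1ℚ} _)

3600³p≤q³⇒10p≤q³ : ∀ p q .{{_ : ℤ.NonNegative p}} → + (3600 ℕ.^ 3) ℤ.* p ℤ.≤ + (q ℕ.^ 3) →
         ⟦ + 10 ⟧ * ⟦ p ⟧ ≤ ⟦ + q ⟧ * ⟦ + q ⟧ * ⟦ + q ⟧
3600³p≤q³⇒10p≤q³ p q 3600³p≤q³ = subst₂ _≤_ (⟦⟧-homo-* (+ 10) p) ⟦q³⟧≡
  (⟦⟧-mono-≤ (ℤP.≤-trans (ℤP.*-monoʳ-≤-nonNeg p (ℤ.+≤+ 10≤3600³)) 3600³p≤q³))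
  where
  10≤3600³ : 10 ℕ.≤ 3600 ℕ.^ 3
  10≤3600³ = toWitness {a? = 10 ℕ.≤? 3600 ℕ.^ 3} _
  q³≡q*q*q : + (q ℕ.^ 3) ≡ + q ℤ.* + q ℤ.* + q
  q³≡q*q*q = begin
    + (q ℕ.* (q ℕ.* (q ℕ.* 1)))  ≡⟨ cong (λ m → + (q ℕ.* (q ℕ.* m))) (ℕP.*-identityʳ q) ⟩
    + (q ℕ.* (q ℕ.* q))          ≡⟨ cong +_ (sym (ℕP.*-assoc q q q)) ⟩
    + (q ℕ.* q ℕ.* q)            ≡⟨ ℤP.pos-* (q ℕ.* q) q ⟩
    + (q ℕ.* q) ℤ.* + q          ≡⟨ cong (ℤ._* + q) (ℤP.pos-* q q) ⟩
    + q ℤ.* + q ℤ.* + q          ∎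
    where open ≡-Reasoning
  ⟦q³⟧≡ : ⟦ + (q ℕ.^ 3) ⟧ ≡ ⟦ + q ⟧ * ⟦ + q ⟧ * ⟦ + q ⟧
  ⟦q³⟧≡ = trans (cong ⟦_⟧ q³≡q*q*q)
    (trans (⟦⟧-homo-* (+ q ℤ.* + q) (+ q)) (cong (_* ⟦ + q ⟧) (⟦⟧-homo-* (+ q) (+ q))))

theorem7p6 : (p : ℤ) (q : ℕ) → ℤ.0ℤ ℤ.< p → 0 ℕ.< q
    → (+ (3600 ℕ.^ 3)) ℤ.* p ℤ.≤ + (q ℕ.^ 3)
    → (t : ℤ)
    → ¬ ((F₂ p q - ⟦ + 10 ⟧ * ⟦ p ⟧ * (+ 1 / 25) * recip q * recip q * recip q < ⟦ t ⟧)
         × (⟦ t ⟧ < F₂ p q))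
theorem7p6 p zero    _   ()
theorem7p6 p (suc n) 0<p _ 3600³p≤q³ t =
  subst (λ F → ¬ (F - δ p q < ⟦ t ⟧ × ⟦ t ⟧ < F)) (sym (F₂≡integerPart-ε p q))
    (no-integer-in-subinterval (evalℤ (p ∷ + q ∷ []) integerPart) t (ε q) (δ p q) (ε-nonNeg q)
      (ε+δ≤1 q p (3600³p≤q³⇒10p≤q³ p q {{ℤ.nonNegative (ℤP.<⇒≤ 0<p)}} 3600³p≤q³) (recip-inverseʳ n)))
  where
  q = suc n
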